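{- Let $m\ge4$ be a divisor of $n$ with $\gcd(m,n/m)=1$, and identify $\mathbb{Z}_n$ with $\mathbb{Z}_{n/m}\times\mathbb{Z}_m$. The number of circulant digraphs $\Gamma$ of order $n$ whose automorphism group contains $K\times S_m$ (acting canonically, $K$ on the first coordinate and $S_m$ on the second) for some 2-closed $K$ with $\mathbb{Z}_{n/m}\le K\le S_{n/m}$ is at most $2^{2n/m}$, and the number of such circulant graphs is at most $2^{n/m+1}$. Equivalently, there are at most $2^{2n/m}$ circulant digraphs and at most $2^{n/m+1}$ circulant graphs of order $n$ of deleted wreath type with divisor $m$.
   Context: Circulant digraphs of order $n$ are $\Gamma(\mathbb{Z}_n,S)$ with vertex set $\mathbb{Z}_n$, arcs $\{(u,v):u-v\in S\}$, $S\subseteq\mathbb{Z}_n\setminus\{0\}$, counted as labelled objects (by $S$); graphs are those with $S=-S$. $\Gamma$ is of deleted wreath type with divisor $m$ if, with $L=\langle n/m\rangle$ the subgroup of order $m$, $S\cap L\in\{\emptyset,L\setminus\{0\}\}$ and for every $g\in\langle m\rangle\setminus\{0\}$, $S\cap(g+L)\in\{\emptyset,\{g\},(g+L)\setminus\{g\},g+L\}$. $\mathbb{Z}_{n/m}\le K$ means $K$ contains the translations of $\mathbb{Z}_{n/m}$; 2-closed means equal to the largest permutation group with the same orbits on ordered pairs. -}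

module Defs where

open import Data.Nat using (ℕ; _+_; _*_; _^_; _≤_)
open import Data.Nat.Divisibility using (_∣_)
open import Data.Integer as ℤ using (ℤ; +_)
open import Data.Integer.Divisibility as ℤD using ()
open import Data.Fin using (Fin; toℕ)
open import Data.Fin.Subset using (Subset; _∈_; _∉_)
open import Data.List using (List; length)
open import Data.List.Relation.Unary.All using (All)
open import Data.List.Relation.Unary.Unique.Propositional using (Unique)
open import Data.Product using (_×_)
open import Data.Sum using (_⊎_)
open import Relation.Binary.PropositionalEquality using (_≡_; _≢_)
open import Relation.Nullary using (¬_)
open import Function.Bundles using (_⇔_)

-- Z_n is represented by Fin n (residues 0..n-1); a circulant digraph
-- Γ(Z_n, S) is identified with its connection set S : Subset n.

ConnectionSet : (n : ℕ) → Subset n → Set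
ConnectionSet n S = (x : Fin n) → toℕ x ≡ 0 → x ∉ S

Symmetric : (n : ℕ) → Subset n → Set
Symmetric n S = (x y : Fin n) → n ∣ (toℕ x + toℕ y) → x ∈ S → y ∈ S

-- y ∈ g + L, where L = ⟨k⟩ is the subgroup of order m (k = n/m):
-- k divides y - g (as integers)
InCoset : {n : ℕ} → (k : ℕ) → (g y : Fin n) → Set
InCoset k g y = (+ k) ℤD.∣ ((+ toℕ y) ℤ.- (+ toℕ g))

CosetCondition : {n : ℕ} → (k : ℕ) → Subset n → Fin n → Set
CosetCondition {n} k S g =
    ((y : Fin n) → InCoset k g y → y ∉ S)
  ⊎ (((y : Fin n) → InCoset k g y → (y ∈ S ⇔ y ≡ g))
  ⊎ (((y : Fin n) → InCoset k g y → (y ∈ S ⇔ y ≢ g))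
  ⊎ ((y : Fin n) → InCoset k g y → y ∈ S)))

-- Γ(Z_n,S) is of deleted wreath type with divisor m, where k = n/m
-- (so L = ⟨k⟩ has order m and ⟨m⟩ is the subgroup generated by m).
DeletedWreathType : (n m k : ℕ) → Subset n → Set
DeletedWreathType n m k S =
    ( ((x : Fin n) → k ∣ toℕ x → ¬ (toℕ x ≡ 0) → x ∉ S)
    ⊎ ((x : Fin n) → k ∣ toℕ x → ¬ (toℕ x ≡ 0) → x ∈ S) )
  × ((g : Fin n) → m ∣ toℕ g → ¬ (toℕ g ≡ 0) → CosetCondition k S g)

-- "the number of S : Subset n satisfying P is at most b":
-- every duplicate-free list of such S has length at most b.
AtMost : (n : ℕ) → (Subset n → Set) → ℕ → Set
AtMost n P b = (Ss : List (Subset n)) → Unique Ss → All P Ss → length Ss ≤ b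

-- Write L = ⟨k⟩ for the subgroup of order m. As gcd(m, k) = 1, every coset of L contains a
-- multiple i·m with i < k. For S of deleted wreath type, S ∩ L is ∅ or L ∖ {0}, so it is
-- fixed by whether k ∈ S; for 0 < i < k, S ∩ (i·m + L) is ∅, {i·m}, (i·m + L) ∖ {i·m} or
-- i·m + L, so it is fixed by whether i·m ∈ S and whether i·m + k ∈ S. Hence S is determined
-- by two bits per coset, at most 4^k = 2^(2k) choices. If moreover S = −S, negation swaps the
-- cosets of i·m and (k − i)·m, so the bit of k and the two bits of each coset with
-- 1 ≤ i ≤ ⌊k/2⌋ suffice: at most 2 · 4^⌊k/2⌋ ≤ 2^(k+1) choices.

module Submission where

open import Defs
open import Data.Bool using (true; false)
open import Data.Empty using (⊥-elim)
open import Data.Fin using (Fin; zero; suc; toℕ; fromℕ<; _≟_; combine; funToFin; finToFun)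
open import Data.Fin.Properties
  using (toℕ<n; toℕ-fromℕ<; toℕ-injective; injective⇒≤; 2↔Bool; combine-injective; finToFun-funToFin)
open import Data.Fin.Subset using (Subset; _∈_)
open import Data.Integer as ℤ using (ℤ; +_; -_; _-_)
import Data.Integer.Properties as ℤ
open import Data.Integer.DivMod using (_%ℕ_; _/ℕ_; n%ℕd<d; a≡a%ℕn+[a/ℕn]*n)
open import Data.Integer.Divisibility.Signed using (_∣_; divides; ∣⇒∣ᵤ; ∣m∣n⇒∣m+n; ∣m⇒∣-m; ∣m⇒∣m*n)
open import Data.Integer.Tactic.RingSolver using (solve-∀)
open import Data.List using (List; _∷_; length; lookup)
open import Data.List.Membership.Propositional.Properties using (∈-lookup)
open import Data.List.Relation.Unary.All as All using (All)
open import Data.List.Relation.Unary.AllPairs using (_∷_)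
open import Data.List.Relation.Unary.Unique.Propositional using (Unique)
open import Data.Nat as ℕ using (ℕ; zero; suc; _+_; _*_; _∸_; _^_; _≤_; _<_; NonZero; ⌊_/2⌋; z≤n; s≤s)
import Data.Nat.Divisibility as ℕ
open import Data.Nat.Coprimality using (Coprime; coprime-Bézout)
open import Data.Nat.DivMod using (_%_; _/_; _mod_; m≡m%n+[m/n]*n)
open import Data.Nat.GCD using (module Bézout)
import Data.Nat.Properties as ℕ
open import Data.Product using (∃-syntax; _×_; _,_; proj₁; proj₂)
open import Data.Sum using (inj₁; inj₂)
open import Data.Vec as Vec using ()
open import Data.Vec.Properties using (tabulate∘lookup; tabulate-cong; []=⇒lookup; lookup⇒[]=)
open import Function using (_∘_)
open import Function.Bundles using (Inverse; Equivalence)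
open import Level using (0ℓ)
open import Relation.Binary.Bundles using (Setoid)
open import Relation.Binary.Structures using (IsEquivalence)
open import Relation.Binary.PropositionalEquality
import Relation.Binary.Reasoning.Setoid as SetoidReasoning
open import Relation.Nullary using (yes; no)

private variable
  A : Set
  n : ℕ

lookup-injective : {xs : List A} → Unique xs → ∀ {i j} → lookup xs i ≡ lookup xs j → i ≡ j
lookup-injective (_ ∷ _) {zero} {zero} _ = refl
lookup-injective (x∉xs ∷ _) {zero} {suc j} eq = ⊥-elim (All.lookup x∉xs (∈-lookup j) eq)
lookup-injective (x∉xs ∷ _) {suc i} {zero} eq = ⊥-elim (All.lookup x∉xs (∈-lookup i) (sym eq))
lookup-injective (_ ∷ xs!) {suc i} {suc j} eq = cong suc (lookup-injective xs! eq)

length≤-injectiveOn : ∀ {P : A → Set} {N} (code : A → Fin N) →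
  (∀ {a b} → P a → P b → code a ≡ code b → a ≡ b) →
  (xs : List A) → Unique xs → All P xs → length xs ≤ N
length≤-injectiveOn code injective xs xs! pxs =
  injective⇒≤ {f = λ i → code (lookup xs i)} λ {i} {j} eq → lookup-injective xs! (injective (All.lookup pxs (∈-lookup i)) (All.lookup pxs (∈-lookup j)) eq)

AtMost-weaken : ∀ {P : Subset n → Set} {a b} → a ≤ b → AtMost n P a → AtMost n P b
AtMost-weaken a≤b atMost Ss Ss! pSs = ℕ.≤-trans (atMost Ss Ss! pSs) a≤b

AtMost-Subset0 : ∀ {P : Subset 0 → Set} {b} → AtMost 0 P (suc b)
AtMost-Subset0 =
  AtMost-weaken (s≤s z≤n) (length≤-injectiveOn (λ _ → zero) λ { {Vec.[]} {Vec.[]} _ _ _ → refl })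

funToFin-injective : ∀ {a b} (f g : Fin a → Fin b) → funToFin f ≡ funToFin g → ∀ i → f i ≡ g i
funToFin-injective f g eq i = begin
  f i                      ≡⟨ finToFun-funToFin f i ⟨
  finToFun (funToFin f) i  ≡⟨ cong (λ c → finToFun c i) eq ⟩
  finToFun (funToFin g) i  ≡⟨ finToFun-funToFin g i ⟩
  g i                      ∎
  where open ≡-Reasoning

lookup-≗⇒≡ : {S T : Subset n} → (∀ x → Vec.lookup S x ≡ Vec.lookup T x) → S ≡ T
lookup-≗⇒≡ {S = S} {T} eq = begin
  S                            ≡⟨ tabulate∘lookup S ⟨
  Vec.tabulate (Vec.lookup S)  ≡⟨ tabulate-cong eq ⟩
  Vec.tabulate (Vec.lookup T)  ≡⟨ tabulate∘lookup T ⟩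
  T                            ∎
  where open ≡-Reasoning

lookup-cong-∈ : ∀ {S : Subset n} {x y} → (x ∈ S → y ∈ S) → (y ∈ S → x ∈ S) →
  Vec.lookup S x ≡ Vec.lookup S y
lookup-cong-∈ {S = S} {x} {y} x⇒y y⇒x with Vec.lookup S x in ex | Vec.lookup S y in ey
... | true  | true  = refl
... | false | false = refl
... | true  | false with () ← trans (sym ([]=⇒lookup (x⇒y (lookup⇒[]= x S ex)))) ey
... | false | true  with () ← trans (sym ([]=⇒lookup (y⇒x (lookup⇒[]= y S ey)))) ex

lookup-0≡false : ∀ {S : Subset n} {y} → ConnectionSet n S → toℕ y ≡ 0 → Vec.lookup S y ≡ false
lookup-0≡false {S = S} {y} 0∉S y≡0 with Vec.lookup S y in eq
... | false = refl
... | true with () ← 0∉S y y≡0 (lookup⇒[]= y S eq)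

membership : Subset n → Fin n → Fin 2
membership S x = Inverse.from 2↔Bool (Vec.lookup S x)

membership-injective : ∀ (S T : Subset n) x y →
  membership S x ≡ membership T y → Vec.lookup S x ≡ Vec.lookup T y
membership-injective S T x y eq = begin
  Vec.lookup S x                      ≡⟨ Inverse.strictlyInverseˡ 2↔Bool _ ⟨
  Inverse.to 2↔Bool (membership S x)  ≡⟨ cong (Inverse.to 2↔Bool) eq ⟩
  Inverse.to 2↔Bool (membership T y)  ≡⟨ Inverse.strictlyInverseˡ 2↔Bool _ ⟩
  Vec.lookup T y                      ∎
  where open ≡-Reasoning

⌊n/2⌋+⌊n/2⌋≤n : ∀ n → ⌊ n /2⌋ + ⌊ n /2⌋ ≤ n
⌊n/2⌋+⌊n/2⌋≤n n =
  ℕ.≤-trans (ℕ.+-monoʳ-≤ ⌊ n /2⌋ (ℕ.⌊n/2⌋≤⌈n/2⌉ n)) (ℕ.≤-reflexive (ℕ.⌊n/2⌋+⌈n/2⌉≡n n))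

m∸n+m∸n≤m : ∀ {m n} → n ≤ m → m < n + n → (m ∸ n) + (m ∸ n) ≤ m
m∸n+m∸n≤m {m} {n} n≤m m<2n = begin
  (m ∸ n) + (m ∸ n)  ≤⟨ ℕ.+-monoʳ-≤ (m ∸ n) (ℕ.<⇒≤ m∸n<n) ⟩
  (m ∸ n) + n        ≡⟨ ℕ.m∸n+n≡m n≤m ⟩
  m                  ∎
  where
  open ℕ.≤-Reasoning
  m∸n<n : m ∸ n < n
  m∸n<n = ℕ.+-cancelʳ-< n (m ∸ n) n (subst (_< n + n) (sym (ℕ.m∸n+n≡m n≤m)) m<2n)

pos-∸ : ∀ {a b} → b ≤ a → + (a ∸ b) ≡ + a - + b
pos-∸ {a} {b} b≤a = sym (trans (ℤ.m-n≡m⊖n a b) (ℤ.⊖-≥ b≤a))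

-- A record, unlike a bare divisibility statement, lets Agda infer a and b from a proof.
infix 4 _≡_modulo_
record _≡_modulo_ (a b : ℤ) (k : ℕ) : Set where
  constructor mod-intro
  field divides-difference : + k ∣ a - b
open _≡_modulo_

module _ {k : ℕ} where

  private
    divides-via : ∀ {x y} → x ≡ y → + k ∣ x → + k ∣ y
    divides-via = subst (+ k ∣_)

  ≡-mod-refl : ∀ {a} → a ≡ a modulo k
  ≡-mod-refl {a} = mod-intro (divides (+ 0) (ℤ.+-inverseʳ a))

  ≡⇒≡-mod : ∀ {a b} → a ≡ b → a ≡ b modulo k
  ≡⇒≡-mod refl = ≡-mod-refl

  ≡-mod-sym : ∀ {a b} → a ≡ b modulo k → b ≡ a modulo k
  ≡-mod-sym {a} {b} (mod-intro k∣a-b) = mod-intro (divides-via (identity a b) (∣m⇒∣-m k∣a-b))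
    where
    identity : ∀ a b → - (a - b) ≡ b - a
    identity = solve-∀

  ≡-mod-trans : ∀ {a b c} → a ≡ b modulo k → b ≡ c modulo k → a ≡ c modulo k
  ≡-mod-trans {a} {b} {c} (mod-intro k∣a-b) (mod-intro k∣b-c) =
    mod-intro (divides-via (identity a b c) (∣m∣n⇒∣m+n k∣a-b k∣b-c))
    where
    identity : ∀ a b c → (a - b) ℤ.+ (b - c) ≡ a - c
    identity = solve-∀

  +-cong-mod : ∀ {a b c d} → a ≡ b modulo k → c ≡ d modulo k → a ℤ.+ c ≡ b ℤ.+ d modulo k
  +-cong-mod {a} {b} {c} {d} (mod-intro k∣a-b) (mod-intro k∣c-d) =
    mod-intro (divides-via (identity a b c d) (∣m∣n⇒∣m+n k∣a-b k∣c-d))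
    where
    identity : ∀ a b c d → (a - b) ℤ.+ (c - d) ≡ (a ℤ.+ c) - (b ℤ.+ d)
    identity = solve-∀

  neg-cong-mod : ∀ {a b} → a ≡ b modulo k → - a ≡ - b modulo k
  neg-cong-mod {a} {b} (mod-intro k∣a-b) = mod-intro (divides-via (identity a b) (∣m⇒∣-m k∣a-b))
    where
    identity : ∀ a b → - (a - b) ≡ - a - - b
    identity = solve-∀

  *-congʳ-mod : ∀ {a b} c → a ≡ b modulo k → a ℤ.* c ≡ b ℤ.* c modulo k
  *-congʳ-mod {a} {b} c (mod-intro k∣a-b) = mod-intro (divides-via (identity a b c) (∣m⇒∣m*n c k∣a-b))
    where
    identity : ∀ a b c → (a - b) ℤ.* c ≡ a ℤ.* c - b ℤ.* c
    identity = solve-∀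

  +-multiple-mod : ∀ a q → a ℤ.+ q ℤ.* + k ≡ a modulo k
  +-multiple-mod a q = mod-intro (divides q (identity a (q ℤ.* + k)))
    where
    identity : ∀ a x → (a ℤ.+ x) - a ≡ x
    identity = solve-∀

  ≡-mod-isEquivalence : IsEquivalence (_≡_modulo k)
  ≡-mod-isEquivalence = record { refl = ≡-mod-refl ; sym = ≡-mod-sym ; trans = ≡-mod-trans }

  ≡-mod⇒InCoset : ∀ {g y : Fin n} → + toℕ y ≡ + toℕ g modulo k → InCoset k g y
  ≡-mod⇒InCoset = ∣⇒∣ᵤ ∘ divides-difference

  ≡-mod-0⇒∣ : ∀ {x} → + x ≡ + 0 modulo k → k ℕ.∣ x
  ≡-mod-0⇒∣ {x} x≡0 = subst (k ℕ.∣_) (ℕ.+-identityʳ x) (∣⇒∣ᵤ (divides-difference x≡0))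

mod-setoid : ℕ → Setoid 0ℓ 0ℓ
mod-setoid k = record { isEquivalence = ≡-mod-isEquivalence {k} }

%-≡-mod : ∀ x k m .{{_ : NonZero (k * m)}} → + (x % (k * m)) ≡ + x modulo k
%-≡-mod x k m = begin
  + (x % N)                            ≈⟨ +-multiple-mod (+ (x % N)) (+ (x / N * m)) ⟨
  + (x % N) ℤ.+ + (x / N * m) ℤ.* + k  ≡⟨ cong (ℤ._+_ (+ (x % N))) (ℤ.pos-* (x / N * m) k) ⟨
  + (x % N) ℤ.+ + (x / N * m * k)      ≡⟨ ℤ.pos-+ (x % N) _ ⟨
  + (x % N + x / N * m * k)            ≡⟨ cong (λ j → + (x % N + j)) (reassoc (x / N)) ⟩
  + (x % N + x / N * N)                ≡⟨ cong +_ (m≡m%n+[m/n]*n x N) ⟨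
  + x                                  ∎
  where
  open SetoidReasoning (mod-setoid k)
  N = k * m
  reassoc : ∀ q → q * m * k ≡ q * N
  reassoc q = trans (ℕ.*-assoc q m k) (cong (q *_) (ℕ.*-comm m k))

mod-inverse : ∀ {m k} → Coprime m k → ∃[ a ] a ℤ.* + m ≡ + 1 modulo k
mod-inverse {m} {k} m⊥k with coprime-Bézout m⊥k
... | Bézout.+- x y 1+yk≡xm = + x , (begin
  + x ℤ.* + m          ≡⟨ ℤ.pos-* x m ⟨
  + (x * m)            ≡⟨ cong +_ 1+yk≡xm ⟨
  + (1 + y * k)        ≡⟨ cong (ℤ._+_ (+ 1)) (ℤ.pos-* y k) ⟩
  + 1 ℤ.+ + y ℤ.* + k  ≈⟨ +-multiple-mod (+ 1) (+ y) ⟩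
  + 1                  ∎)
  where open SetoidReasoning (mod-setoid k)
... | Bézout.-+ x y 1+xm≡yk = - + x , (begin
  - + x ℤ.* + m                    ≡⟨ identity (+ x) (+ m) ⟩
  + 1 - (+ 1 ℤ.+ + x ℤ.* + m)      ≡⟨ cong (λ c → + 1 - (+ 1 ℤ.+ c)) (ℤ.pos-* x m) ⟨
  + 1 - + (1 + x * m)              ≡⟨ cong (λ c → + 1 - + c) 1+xm≡yk ⟩
  + 1 - + (y * k)                  ≡⟨ cong (λ c → + 1 - c) (ℤ.pos-* y k) ⟩
  + 1 - + y ℤ.* + k                ≡⟨ cong (ℤ._+_ (+ 1)) (ℤ.neg-distribˡ-* (+ y) (+ k)) ⟩
  + 1 ℤ.+ - + y ℤ.* + k            ≈⟨ +-multiple-mod (+ 1) (- + y) ⟩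
  + 1                              ∎)
  where
  open SetoidReasoning (mod-setoid k)
  identity : ∀ c d → - c ℤ.* d ≡ + 1 - (+ 1 ℤ.+ c ℤ.* d)
  identity = solve-∀

multiples-cover : ∀ {m k} .{{_ : NonZero k}} → Coprime m k →
  (t : ℤ) → ∃[ i ] t ≡ + (toℕ {k} i * m) modulo k
multiples-cover {m} {k} m⊥k t = fromℕ< (n%ℕd<d ta k) , (begin
  t                      ≡⟨ ℤ.*-identityˡ t ⟨
  + 1 ℤ.* t              ≈⟨ *-congʳ-mod t (≡-mod-sym (proj₂ (mod-inverse m⊥k))) ⟩
  a ℤ.* + m ℤ.* t        ≡⟨ reorder a (+ m) t ⟩
  ta ℤ.* + m             ≈⟨ *-congʳ-mod (+ m) ta≡r ⟩
  + r ℤ.* + m            ≡⟨ ℤ.pos-* r m ⟨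
  + (r * m)              ≡⟨ cong (λ j → + (j * m)) (toℕ-fromℕ< (n%ℕd<d ta k)) ⟨
  + (toℕ (fromℕ< (n%ℕd<d ta k)) * m) ∎)
  where
  open SetoidReasoning (mod-setoid k)
  a = proj₁ (mod-inverse m⊥k)
  ta = t ℤ.* a
  r = ta %ℕ k
  reorder : ∀ a m t → a ℤ.* m ℤ.* t ≡ t ℤ.* a ℤ.* m
  reorder = solve-∀
  ta≡r : ta ≡ + r modulo k
  ta≡r = begin
    ta                         ≡⟨ a≡a%ℕn+[a/ℕn]*n ta k ⟩
    + r ℤ.+ (ta /ℕ k) ℤ.* + k  ≈⟨ +-multiple-mod (+ r) (ta /ℕ k) ⟩
    + r                        ∎

negate : (x : Fin n) → .(toℕ x ≢ 0) → Fin n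
negate x x≢0 = fromℕ< (ℕ.∸-monoʳ-< (ℕ.n≢0⇒n>0 x≢0) (ℕ.<⇒≤ (toℕ<n x)))

toℕ-negate : ∀ (x : Fin n) .(x≢0 : toℕ x ≢ 0) → toℕ (negate x x≢0) ≡ n ∸ toℕ x
toℕ-negate x x≢0 = toℕ-fromℕ< _

lookup-negate : ∀ {S : Subset n} → Symmetric n S → ∀ x .(x≢0 : toℕ x ≢ 0) →
  Vec.lookup S x ≡ Vec.lookup S (negate x x≢0)
lookup-negate {n} symmetric x x≢0 =
  lookup-cong-∈ (symmetric x (negate x x≢0) n∣x+x′) (symmetric (negate x x≢0) x n∣x′+x)
  where
  x+x′≡n : toℕ x + toℕ (negate x x≢0) ≡ n
  x+x′≡n = trans (cong (λ j → toℕ x + j) (toℕ-negate x x≢0)) (ℕ.m+[n∸m]≡n (ℕ.<⇒≤ (toℕ<n x)))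
  n∣x+x′ : n ℕ.∣ toℕ x + toℕ (negate x x≢0)
  n∣x+x′ = ℕ.∣-reflexive (sym x+x′≡n)
  n∣x′+x : n ℕ.∣ toℕ (negate x x≢0) + toℕ x
  n∣x′+x = ℕ.∣-reflexive (sym (trans (ℕ.+-comm _ (toℕ x)) x+x′≡n))

module _ {m k : ℕ} {S : Subset n} (wreath : DeletedWreathType n m k S) where

  lookup-constant-on-L∖0 : ∀ {y z} → k ℕ.∣ toℕ y → toℕ y ≢ 0 → k ℕ.∣ toℕ z → toℕ z ≢ 0 →
    Vec.lookup S y ≡ Vec.lookup S z
  lookup-constant-on-L∖0 {y} {z} k∣y y≢0 k∣z z≢0 with proj₁ wreath
  ... | inj₁ empty = lookup-cong-∈ (⊥-elim ∘ empty y k∣y y≢0) (⊥-elim ∘ empty z k∣z z≢0)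
  ... | inj₂ full  = lookup-cong-∈ (λ _ → full z k∣z z≢0) (λ _ → full y k∣y y≢0)

  lookup-constant-on-coset∖g : ∀ {g y z} → m ℕ.∣ toℕ g → toℕ g ≢ 0 →
    InCoset k g y → y ≢ g → InCoset k g z → z ≢ g → Vec.lookup S y ≡ Vec.lookup S z
  lookup-constant-on-coset∖g {g} {y} {z} m∣g g≢0 y∈g+L y≢g z∈g+L z≢g with proj₂ wreath g m∣g g≢0
  ... | inj₁ empty =
    lookup-cong-∈ (⊥-elim ∘ empty y y∈g+L) (⊥-elim ∘ empty z z∈g+L)
  ... | inj₂ (inj₁ singleton) =
    lookup-cong-∈ (⊥-elim ∘ y≢g ∘ Equivalence.to (singleton y y∈g+L))
                  (⊥-elim ∘ z≢g ∘ Equivalence.to (singleton z z∈g+L))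
  ... | inj₂ (inj₂ (inj₁ punctured)) =
    lookup-cong-∈ (λ _ → Equivalence.from (punctured z z∈g+L) z≢g)
                  (λ _ → Equivalence.from (punctured y y∈g+L) y≢g)
  ... | inj₂ (inj₂ (inj₂ full)) =
    lookup-cong-∈ (λ _ → full z z∈g+L) (λ _ → full y y∈g+L)

module DeletedWreathCount (k m : ℕ) .{{_ : NonZero k}} (1<m : 1 < m) (m⊥k : Coprime m k) where

  N : ℕ
  N = k * m

  instance
    m≢0 : NonZero m
    m≢0 = ℕ.>-nonZero (ℕ.<-trans ℕ.z<s 1<m)
    N≢0 : NonZero N
    N≢0 = ℕ.m*n≢0 k m

  k<N : k < N
  k<N = ℕ.m<m*n k m 1<m

  Wreath : Subset N → Set
  Wreath S = ConnectionSet N S × DeletedWreathType N m k S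

  AgreeAt : Subset N → Subset N → Fin N → Set
  AgreeAt S T x = Vec.lookup S x ≡ Vec.lookup T x

  -- The two points of the coset i·m + L whose membership in S is recorded.
  rep : Fin k → Fin N
  rep i = fromℕ< (ℕ.*-monoˡ-< m (toℕ<n i))

  other : ℕ → Fin N
  other i = (i * m + k) mod N

  toℕ-rep : ∀ i → toℕ (rep i) ≡ toℕ i * m
  toℕ-rep i = toℕ-fromℕ< _

  toℕ-other : ∀ i → toℕ (other i) ≡ (i * m + k) % N
  toℕ-other i = toℕ-fromℕ< _

  other-≡-mod : ∀ i → + toℕ (other i) ≡ + (i * m) modulo k
  other-≡-mod i = begin
    + toℕ (other i)          ≡⟨ cong +_ (toℕ-other i) ⟩
    + ((i * m + k) % N)      ≈⟨ %-≡-mod (i * m + k) k m ⟩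
    + (i * m + k)            ≡⟨ ℤ.pos-+ (i * m) k ⟩
    + (i * m) ℤ.+ + k        ≡⟨ cong (ℤ._+_ (+ (i * m))) (ℤ.*-identityˡ (+ k)) ⟨
    + (i * m) ℤ.+ + 1 ℤ.* + k ≈⟨ +-multiple-mod (+ (i * m)) (+ 1) ⟩
    + (i * m)                ∎
    where open SetoidReasoning (mod-setoid k)

  other≢multiple : ∀ i → toℕ (other i) ≢ i * m
  other≢multiple i other≡im = k≢multiple-of-N q (ℕ.+-cancelˡ-≡ (i * m) k (q * N) (begin
    i * m + k                ≡⟨ m≡m%n+[m/n]*n (i * m + k) N ⟩
    (i * m + k) % N + q * N  ≡⟨ cong (_+ q * N) (trans (sym (toℕ-other i)) other≡im) ⟩
    i * m + q * N            ∎))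
    where
    open ≡-Reasoning
    q = (i * m + k) / N
    k≢multiple-of-N : ∀ q → k ≢ q * N
    k≢multiple-of-N zero    k≡0  = ℕ.≢-nonZero⁻¹ k k≡0
    k≢multiple-of-N (suc q) k≡qN = ℕ.<⇒≱ k<N (subst (N ≤_) (sym k≡qN) (ℕ.m≤m+n N (q * N)))

  CosetAgree : Subset N → Subset N → Fin k → Set
  CosetAgree S T i = AgreeAt S T (rep i) × AgreeAt S T (other (toℕ i))

  agree-at-zero : ∀ {S T} → Wreath S → Wreath T → ∀ {y} → toℕ y ≡ 0 → AgreeAt S T y
  agree-at-zero (0∉S , _) (0∉T , _) y≡0 =
    trans (lookup-0≡false 0∉S y≡0) (sym (lookup-0≡false 0∉T y≡0))

  agree-in-L : ∀ {S T} → Wreath S → Wreath T → AgreeAt S T (other 0) →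
    ∀ {y} → + toℕ y ≡ + 0 modulo k → toℕ y ≢ 0 → AgreeAt S T y
  agree-in-L {S} {T} (_ , wS) (_ , wT) agree-other {y} y≡0 y≢0 = begin
    Vec.lookup S y          ≡⟨ lookup-constant-on-L∖0 wS k∣y y≢0 k∣other other≢0 ⟩
    Vec.lookup S (other 0)  ≡⟨ agree-other ⟩
    Vec.lookup T (other 0)  ≡⟨ lookup-constant-on-L∖0 wT k∣y y≢0 k∣other other≢0 ⟨
    Vec.lookup T y          ∎
    where
    open ≡-Reasoning
    k∣y = ≡-mod-0⇒∣ y≡0
    k∣other = ≡-mod-0⇒∣ (other-≡-mod 0)
    other≢0 = other≢multiple 0

  agree-in-nontrivial-coset : ∀ {S T} → Wreath S → Wreath T → ∀ i → toℕ i ≢ 0 → CosetAgree S T i →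
    ∀ y → + toℕ y ≡ + (toℕ i * m) modulo k → AgreeAt S T y
  agree-in-nontrivial-coset {S} {T} (_ , wS) (_ , wT) i i≢0 (agree-rep , agree-other) y y≡im
    with y ≟ rep i
  ... | yes refl = agree-rep
  ... | no y≢g = begin
    Vec.lookup S y                 ≡⟨ lookup-constant-on-coset∖g wS m∣g g≢0 y∈g+L y≢g other∈g+L other≢g ⟩
    Vec.lookup S (other (toℕ i))   ≡⟨ agree-other ⟩
    Vec.lookup T (other (toℕ i))   ≡⟨ lookup-constant-on-coset∖g wT m∣g g≢0 y∈g+L y≢g other∈g+L other≢g ⟨
    Vec.lookup T y                 ∎
    where
    open ≡-Reasoning
    g = rep i
    m∣g : m ℕ.∣ toℕ g
    m∣g = ℕ.divides (toℕ i) (toℕ-rep i)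
    g≢0 : toℕ g ≢ 0
    g≢0 = i≢0 ∘ ℕ.m*n≡0⇒m≡0 (toℕ i) m ∘ trans (sym (toℕ-rep i))
    ≡-mod-g : ∀ {x} → + toℕ x ≡ + (toℕ i * m) modulo k → InCoset k g x
    ≡-mod-g x≡im = ≡-mod⇒InCoset (≡-mod-trans x≡im (≡⇒≡-mod (cong +_ (sym (toℕ-rep i)))))
    y∈g+L = ≡-mod-g y≡im
    other∈g+L = ≡-mod-g (other-≡-mod (toℕ i))
    other≢g : other (toℕ i) ≢ g
    other≢g other≡g = other≢multiple (toℕ i) (trans (cong toℕ other≡g) (toℕ-rep i))

  agree-in-coset : ∀ {S T} → Wreath S → Wreath T → AgreeAt S T (other 0) →
    ∀ i → (toℕ i ≢ 0 → CosetAgree S T i) → ∀ y → + toℕ y ≡ + (toℕ i * m) modulo k → AgreeAt S T y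
  agree-in-coset wS wT agree-other i agree-i y y≡im with toℕ y ℕ.≟ 0 | toℕ i ℕ.≟ 0
  ... | yes y≡0 | _        = agree-at-zero wS wT y≡0
  ... | no y≢0  | yes i≡0  =
    agree-in-L wS wT agree-other (subst (λ j → + toℕ y ≡ + (j * m) modulo k) i≡0 y≡im) y≢0
  ... | no _    | no i≢0   = agree-in-nontrivial-coset wS wT i i≢0 (agree-i i≢0) y y≡im

  determined-by-cosets : ∀ {S T} → Wreath S → Wreath T → (∀ i → CosetAgree S T i) → S ≡ T
  determined-by-cosets {S} {T} wS wT agree = lookup-≗⇒≡ λ y →
    let i , y≡im = multiples-cover m⊥k (+ toℕ y)
    in agree-in-coset wS wT agree-other i (λ _ → agree i) y y≡im
    where
    0<k : 0 < k
    0<k = ℕ.>-nonZero⁻¹ k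
    agree-other : AgreeAt S T (other 0)
    agree-other = subst (AgreeAt S T ∘ other) (toℕ-fromℕ< 0<k) (proj₂ (agree (fromℕ< 0<k)))

  SymWreath : Subset N → Set
  SymWreath S = ConnectionSet N S × Symmetric N S × DeletedWreathType N m k S

  negate-≡-mod : ∀ {y i} .(y≢0 : toℕ y ≢ 0) → i ≤ k →
    + toℕ y ≡ + (i * m) modulo k → + toℕ (negate y y≢0) ≡ + ((k ∸ i) * m) modulo k
  negate-≡-mod {y} {i} y≢0 i≤k y≡im = begin
    + toℕ (negate y y≢0)   ≡⟨ cong +_ (toℕ-negate y y≢0) ⟩
    + (N ∸ toℕ y)          ≡⟨ pos-∸ (ℕ.<⇒≤ (toℕ<n y)) ⟩
    + N - + toℕ y          ≈⟨ +-cong-mod (≡-mod-refl {a = + N}) (neg-cong-mod y≡im) ⟩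
    + N - + (i * m)        ≡⟨ pos-∸ (ℕ.*-monoˡ-≤ m i≤k) ⟨
    + (N ∸ i * m)          ≡⟨ cong +_ (ℕ.*-distribʳ-∸ m k i) ⟨
    + ((k ∸ i) * m)        ∎
    where open SetoidReasoning (mod-setoid k)

  determined-by-half-cosets : ∀ {S T} → SymWreath S → SymWreath T → AgreeAt S T (other 0) →
    (∀ i → toℕ i ≢ 0 → toℕ i + toℕ i ≤ k → CosetAgree S T i) → S ≡ T
  determined-by-half-cosets {S} {T} (0∉S , symS , wS) (0∉T , symT , wT) agree-other agree =
    lookup-≗⇒≡ λ y → let i , y≡im = multiples-cover m⊥k (+ toℕ y) in agree-anywhere i y y≡im
    where
    agree-in-small-coset : ∀ i → toℕ i + toℕ i ≤ k →
      ∀ y → + toℕ y ≡ + (toℕ i * m) modulo k → AgreeAt S T y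
    agree-in-small-coset i 2i≤k =
      agree-in-coset (0∉S , wS) (0∉T , wT) agree-other i (λ i≢0 → agree i i≢0 2i≤k)
    agree-anywhere : ∀ i y → + toℕ y ≡ + (toℕ i * m) modulo k → AgreeAt S T y
    agree-anywhere i y y≡im with toℕ i + toℕ i ℕ.≤? k | toℕ y ℕ.≟ 0
    ... | yes 2i≤k | _       = agree-in-small-coset i 2i≤k y y≡im
    ... | no _     | yes y≡0 = agree-at-zero (0∉S , wS) (0∉T , wT) y≡0
    ... | no 2i≰k  | no y≢0  = begin
      Vec.lookup S y                ≡⟨ lookup-negate symS y y≢0 ⟩
      Vec.lookup S (negate y y≢0)   ≡⟨ agree-in-small-coset i′ 2i′≤k (negate y y≢0) y′≡i′m ⟩
      Vec.lookup T (negate y y≢0)   ≡⟨ lookup-negate symT y y≢0 ⟨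
      Vec.lookup T y                ∎
      where
      open ≡-Reasoning
      i≤k = ℕ.<⇒≤ (toℕ<n i)
      i≢0 : toℕ i ≢ 0
      i≢0 i≡0 = 2i≰k (subst (λ j → j + j ≤ k) (sym i≡0) z≤n)
      i′ = negate i i≢0
      2i′≤k : toℕ i′ + toℕ i′ ≤ k
      2i′≤k = subst (λ j → j + j ≤ k) (sym (toℕ-negate i i≢0)) (m∸n+m∸n≤m i≤k (ℕ.≰⇒> 2i≰k))
      y′≡i′m : + toℕ (negate y y≢0) ≡ + (toℕ i′ * m) modulo k
      y′≡i′m = subst (λ j → + toℕ (negate y y≢0) ≡ + (j * m) modulo k) (sym (toℕ-negate i i≢0))
                     (negate-≡-mod y≢0 i≤k y≡im)

  cosetCode : Subset N → Fin k → Fin 4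
  cosetCode S i = combine (membership S (rep i)) (membership S (other (toℕ i)))

  cosetCode-injective : ∀ {S T} i → cosetCode S i ≡ cosetCode T i → CosetAgree S T i
  cosetCode-injective {S} {T} i eq
    with combine-injective (membership S (rep i)) (membership S (other (toℕ i)))
                           (membership T (rep i)) (membership T (other (toℕ i))) eq
  ... | rep-bits , other-bits = membership-injective S T (rep i) (rep i) rep-bits
                              , membership-injective S T (other (toℕ i)) (other (toℕ i)) other-bits

  digraphs-atMost : AtMost N Wreath (2 ^ (2 * k))
  digraphs-atMost = AtMost-weaken (ℕ.≤-reflexive (ℕ.^-*-assoc 2 2 k))
    (length≤-injectiveOn (funToFin ∘ cosetCode) λ {S} {T} wS wT eq →
      determined-by-cosets wS wT λ i →
        cosetCode-injective {S} {T} i (funToFin-injective (cosetCode S) (cosetCode T) eq i))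

  half : ℕ
  half = ⌊ k /2⌋

  small : Fin half → Fin k
  small j = fromℕ< (ℕ.<-≤-trans (ℕ.m<m+n (suc (toℕ j)) ℕ.z<s)
                                (ℕ.≤-trans (ℕ.+-mono-≤ (toℕ<n j) (toℕ<n j)) (⌊n/2⌋+⌊n/2⌋≤n k)))

  toℕ-small : ∀ j → toℕ (small j) ≡ suc (toℕ j)
  toℕ-small j = toℕ-fromℕ< _

  small-surjective : ∀ i → toℕ i ≢ 0 → toℕ i + toℕ i ≤ k → ∃[ j ] small j ≡ i
  small-surjective i i≢0 2i≤k with toℕ i in toℕi≡
  ... | zero  = ⊥-elim (i≢0 refl)
  ... | suc j = fromℕ< j<half ,
    toℕ-injective (trans (toℕ-small _) (trans (cong suc (toℕ-fromℕ< j<half)) (sym toℕi≡)))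
    where
    j<half : j < half
    j<half = ℕ.≤-trans (ℕ.≤-reflexive (ℕ.n≡⌊n+n/2⌋ (suc j))) (ℕ.⌊n/2⌋-mono 2i≤k)

  graphCode : Subset N → Fin (2 * 4 ^ half)
  graphCode S = combine (membership S (other 0)) (funToFin (cosetCode S ∘ small))

  graphs-atMost : AtMost N SymWreath (2 ^ (k + 1))
  graphs-atMost = AtMost-weaken bound (length≤-injectiveOn graphCode injective)
    where
    injective : ∀ {S T} → SymWreath S → SymWreath T → graphCode S ≡ graphCode T → S ≡ T
    injective {S} {T} wS wT eq
      with combine-injective (membership S (other 0)) (funToFin (cosetCode S ∘ small))
                             (membership T (other 0)) (funToFin (cosetCode T ∘ small)) eq
    ... | other-bit , small-bits =
      determined-by-half-cosets wS wT (membership-injective S T (other 0) (other 0) other-bit) agree-small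
      where
      agree-small : ∀ i → toℕ i ≢ 0 → toℕ i + toℕ i ≤ k → CosetAgree S T i
      agree-small i i≢0 2i≤k with small-surjective i i≢0 2i≤k
      ... | j , refl = cosetCode-injective {S} {T} (small j)
        (funToFin-injective (cosetCode S ∘ small) (cosetCode T ∘ small) small-bits j)
    bound : 2 * 4 ^ half ≤ 2 ^ (k + 1)
    bound = begin
      2 * 4 ^ half         ≡⟨ cong (2 *_) (ℕ.^-*-assoc 2 2 half) ⟩
      2 ^ suc (2 * half)   ≤⟨ ℕ.^-monoʳ-≤ 2 (s≤s 2*half≤k) ⟩
      2 ^ suc k            ≡⟨ cong (2 ^_) (ℕ.+-comm 1 k) ⟩
      2 ^ (k + 1)          ∎
      where
      open ℕ.≤-Reasoning
      2*half≤k : 2 * half ≤ k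
      2*half≤k = subst (_≤ k) (cong (_+_ half) (sym (ℕ.+-identityʳ half))) (⌊n/2⌋+⌊n/2⌋≤n k)

corollary2p17 : (n m k : ℕ) → n ≡ k * m → 4 ≤ m → Coprime m k →
    AtMost n (λ S → ConnectionSet n S × DeletedWreathType n m k S) (2 ^ (2 * k))
    × AtMost n (λ S → ConnectionSet n S × Symmetric n S × DeletedWreathType n m k S) (2 ^ (k + 1))
corollary2p17 .(zero * m) m zero refl _ _ = AtMost-Subset0 , AtMost-Subset0
corollary2p17 .(suc k * m) m (suc k) refl 4≤m m⊥k = digraphs-atMost , graphs-atMost
  where open DeletedWreathCount (suc k) m (ℕ.<-≤-trans (s≤s (s≤s z≤n)) 4≤m) m⊥k
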